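{- Fix a lexicographic order on strings induced by a total order on the alphabet. Let $v$ be a Lyndon word. Then there is no Lyndon word $w$ that can be written as $w = xyz$ for strings $x, y, z$ such that $x$ is a non-empty suffix of $v$ and $z$ is a non-empty prefix of $v$.
   Context: A non-empty string $w$ is a Lyndon word (with respect to the fixed lexicographic order) if $w$ is lexicographically smaller than each of its non-empty proper suffixes. The string $y$ may be empty. -}

module Defs where

open import Level using (Level)
open import Data.List using (List; []; _∷_; _++_)
open import Data.Product using (Σ; ∃; _×_; _,_)
open import Relation.Binary.Bundles using (StrictTotalOrder)
open import Relation.Binary.PropositionalEquality using (_≡_)
open import Relation.Nullary using (¬_)
open import Data.List.Relation.Binary.Lex.Core using (Lex-<)

module LyndonDefs {a ℓ₁ ℓ₂ : Level} (O : StrictTotalOrder a ℓ₁ ℓ₂) where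
  open StrictTotalOrder O renaming (Carrier to A; _<_ to _≺_)

  -- lexicographic strict order on strings induced by the total order on the alphabet
  -- (a proper prefix is smaller)
  _<ₗ_ : List A → List A → Set _
  _<ₗ_ = Lex-< _≈_ _≺_

  NonEmpty : List A → Set a
  NonEmpty u = ¬ (u ≡ [])

  ProperSuffix : List A → List A → Set a
  ProperSuffix s w = Σ (List A) λ p → NonEmpty p × NonEmpty s × (w ≡ p ++ s)

  IsSuffix : List A → List A → Set a
  IsSuffix s w = Σ (List A) λ p → w ≡ p ++ s

  IsPrefix : List A → List A → Set a
  IsPrefix p w = Σ (List A) λ s → w ≡ p ++ s

  Lyndon : List A → Set _
  Lyndon w = NonEmpty w × (∀ s → ProperSuffix s w → w <ₗ s)

module Submission where

-- Let v be Lyndon, x a non-empty suffix and z a non-empty prefix of v,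
-- and suppose w = x ++ y ++ z were Lyndon.  Then z is a proper suffix of w
-- and x is a proper prefix of w, so lexicographically
--
--     w <ₗ z ≤ₗ v ≤ₗ x <ₗ w,
--
-- where z ≤ₗ v because prefixes are never larger, and v ≤ₗ x because v is
-- Lyndon.  Hence w <ₗ w by transitivity, contradicting asymmetry of <ₗ.

open import Defs
open import Level using (Level)
open import Data.List using (List; []; _∷_; _++_)
open import Data.List.Properties using (++-assoc; ++-identityʳ; ++-conicalˡ; ++-conicalʳ)
open import Data.Product using (_,_; proj₂)
open import Data.Sum using (_⊎_; inj₁; inj₂)
open import Relation.Binary.Bundles using (StrictTotalOrder)
open import Relation.Nullary using (¬_)
open import Relation.Binary.PropositionalEquality using (_≡_; refl; sym; trans; subst)
open import Data.Empty using (⊥)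
open import Data.List.Relation.Binary.Lex.Core using (halt; next)
open import Data.List.Relation.Binary.Lex.Strict using (<-transitive; <-asymmetric)

module LexFacts {a ℓ₁ ℓ₂ : Level} (O : StrictTotalOrder a ℓ₁ ℓ₂) where
  open StrictTotalOrder O renaming (Carrier to A; _<_ to _≺_; trans to ≺-trans)
  open LyndonDefs O

  _≤ₗ_ : List A → List A → Set _
  u ≤ₗ v = (u <ₗ v) ⊎ (u ≡ v)

  <ₗ-trans : ∀ {u v t} → u <ₗ v → v <ₗ t → u <ₗ t
  <ₗ-trans = <-transitive isEquivalence <-resp-≈ ≺-trans

  <ₗ-asym : ∀ {u v} → u <ₗ v → ¬ (v <ₗ u)
  <ₗ-asym = <-asymmetric Eq.sym <-resp-≈ asym

  <ₗ-≤ₗ-trans : ∀ {u v t} → u <ₗ v → v ≤ₗ t → u <ₗ t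
  <ₗ-≤ₗ-trans u<v (inj₁ v<t)  = <ₗ-trans u<v v<t
  <ₗ-≤ₗ-trans u<v (inj₂ refl) = u<v

  proper-prefix-<ₗ : (u s : List A) → NonEmpty s → u <ₗ (u ++ s)
  proper-prefix-<ₗ []      []      s≢[] with () ← s≢[] refl
  proper-prefix-<ₗ []      (c ∷ s) s≢[] = halt
  proper-prefix-<ₗ (c ∷ u) s       s≢[] = next Eq.refl (proper-prefix-<ₗ u s s≢[])

  prefix-≤ₗ : {u v : List A} → IsPrefix u v → u ≤ₗ v
  prefix-≤ₗ {u} ([] , v≡u++[])    = inj₂ (sym (trans v≡u++[] (++-identityʳ u)))
  prefix-≤ₗ {u} (c ∷ s , v≡u++cs) =
    inj₁ (subst (u <ₗ_) (sym v≡u++cs) (proper-prefix-<ₗ u (c ∷ s) λ ()))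

  lyndon-≤ₗ-suffix : {v x : List A} → Lyndon v → NonEmpty x → IsSuffix x v → v ≤ₗ x
  lyndon-≤ₗ-suffix lv x≢[] ([]    , v≡x)    = inj₂ v≡x
  lyndon-≤ₗ-suffix lv x≢[] (c ∷ p , v≡cp++x) = inj₁ (proj₂ lv _ (c ∷ p , (λ ()) , x≢[] , v≡cp++x))

  nonEmpty-++ˡ : (x y : List A) → NonEmpty x → NonEmpty (x ++ y)
  nonEmpty-++ˡ x y x≢[] xy≡[] = x≢[] (++-conicalˡ x y xy≡[])

  nonEmpty-++ʳ : (x y : List A) → NonEmpty y → NonEmpty (x ++ y)
  nonEmpty-++ʳ x y y≢[] xy≡[] = y≢[] (++-conicalʳ x y xy≡[])

lemma2 : {a ℓ₁ ℓ₂ : Level} (O : StrictTotalOrder a ℓ₁ ℓ₂) →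
    let open LyndonDefs O in
    (v w x y z : List (StrictTotalOrder.Carrier O)) →
    Lyndon v → Lyndon w → w ≡ x ++ y ++ z →
    NonEmpty x → IsSuffix x v → NonEmpty z → IsPrefix z v → ⊥
lemma2 O v w x y z lv lw w≡xyz x≢[] x-suffix z≢[] z-prefix = <ₗ-asym w<x x<w
  where
  open LexFacts O
  open LyndonDefs O

  -- z is a proper suffix of the Lyndon word w = (x ++ y) ++ z.
  w<z : w <ₗ z
  w<z = proj₂ lw z (x ++ y , nonEmpty-++ˡ x y x≢[] , z≢[] , trans w≡xyz (sym (++-assoc x y z)))

  w<x : w <ₗ x
  w<x = <ₗ-≤ₗ-trans (<ₗ-≤ₗ-trans w<z (prefix-≤ₗ z-prefix)) (lyndon-≤ₗ-suffix lv x≢[] x-suffix)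

  -- x is a proper prefix of w, since the remainder y ++ z contains z ≠ [].
  x<w : x <ₗ w
  x<w = subst (x <ₗ_) (sym w≡xyz) (proper-prefix-<ₗ x (y ++ z) (nonEmpty-++ʳ y z z≢[]))
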